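{- For a prime $p$, all $n\ge1$ and all $\pi\in\Pi_n$, $H_p(\pi_1,\dots,\pi_n)=h(\pi_1,\dots,\pi_n)$.
   Context: $\Pi_n=\{\pi\in(\mathbb{Z}/p\mathbb{Z})^n:\sum_i\pi_i=1\}$; $H_p(\pi)=\frac1p(1-\sum_ia_i^p)\in\mathbb{Z}/p\mathbb{Z}$ where $a_i\in\mathbb{Z}$ represents $\pi_i$ (independent of choices). $h(x_1,\dots,x_n)\in(\mathbb{Z}/p\mathbb{Z})[x_1,\dots,x_n]$ is $h=-\sum\frac{x_1^{r_1}\cdots x_n^{r_n}}{r_1!\cdots r_n!}$, summed over $0\le r_1,\dots,r_n<p$ with $r_1+\cdots+r_n=p$. -}

module Defs where

open import Data.Nat using (ℕ; zero; suc; _+_; _*_; _∸_; _^_; NonZero; _≟_; _!)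
open import Data.Nat.DivMod using (_%_)
open import Data.Fin using (Fin; toℕ)
open import Data.List using (List; []; _∷_; upTo; concatMap; filter) renaming (map to mapL)
open import Data.Nat.ListAction using () renaming (sum to sumL)
open import Data.Vec using (Vec; []; _∷_; map; sum; zipWith; foldr)
open import Data.Integer using (ℤ; +_; _-_)
open import Data.Integer.DivMod using (_/ℕ_; _%ℕ_)
open import Relation.Nullary.Decidable using (does)
open import Data.Bool using (true; false)
open import Relation.Binary.PropositionalEquality using (_≡_)

-- Elements of Z/pZ are represented by natural numbers; all arithmetic is
-- reduced modulo p.  An element π of (Z/pZ)^n is a vector of Fin p.

rep : ∀ {p n} → Vec (Fin p) n → Vec ℕ n
rep = map toℕ

InΠ : (p : ℕ) .{{_ : NonZero p}} → ∀ {n} → Vec (Fin p) n → Set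
InΠ p π = sum (rep π) % p ≡ 1 % p

Hp : (p : ℕ) .{{_ : NonZero p}} → ∀ {n} → Vec (Fin p) n → ℕ
Hp p π = ((+ 1 - + sum (map (λ a → a ^ p) (rep π))) /ℕ p) %ℕ p

-- multiplicative inverse mod p: the least y < p with r * y ≡ 1 (mod p)
-- (0 if there is none; never happens for r ≢ 0 mod p, p prime)
invMod : (p : ℕ) .{{_ : NonZero p}} → ℕ → ℕ
invMod p r = go (upTo p)
  where
  go : List ℕ → ℕ
  go [] = 0
  go (y ∷ ys) with does ((r * y) % p ≟ 1 % p)
  ... | true  = y
  ... | false = go ys

tuples : (p n : ℕ) → List (Vec ℕ n)
tuples p zero    = [] ∷ []
tuples p (suc n) = concatMap (λ r → mapL (r ∷_) (tuples p n)) (upTo p)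

exponents : (p n : ℕ) → List (Vec ℕ n)
exponents p n = filter (λ r → sum r ≟ p) (tuples p n)

term : (p : ℕ) .{{_ : NonZero p}} → ∀ {n} → Vec ℕ n → Vec ℕ n → ℕ
term p x r =
  (foldr _ _*_ 1 (zipWith _^_ x r) * foldr _ _*_ 1 (map (λ k → invMod p (k !)) r)) % p

h : (p : ℕ) .{{_ : NonZero p}} → ∀ {n} → Vec (Fin p) n → ℕ
h p {n} π = (p ∸ (sumL (mapL (term p (rep π)) (exponents p n)) % p)) % p

module Submission where

open import Defs
import Algebra.Properties.CommutativeSemiring.Binomial as Binomial
import Algebra.Definitions.RawSemiring as RawSemiring
open import Data.Bool using (Bool; true; false; T; if_then_else_)
open import Data.Bool.Properties using (T-≡)
open import Data.Empty using (⊥-elim)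
open import Data.Fin using (Fin; toℕ)
import Data.Integer as ℤ
open import Data.Integer.DivMod using (_/ℕ_; _%ℕ_)
open import Data.List using (List; []; _∷_; upTo; applyUpTo; concatMap; filter) renaming (map to mapL)
open import Data.List.Membership.Propositional.Properties using (∈-upTo⁺)
open import Data.List.Properties using (map-cong; map-++)
open import Data.List.Relation.Unary.Any as Any using (Any; here; there)
open import Data.Nat
open import Data.Nat.Combinatorics using (_C_; nCn≡1; k![n∸k]!∣n!)
open import Data.Nat.Combinatorics.Specification using (nCk≡n!/k![n-k]!)
open import Data.Nat.Coprimality using (prime⇒coprime; coprime-Bézout)
open import Data.Nat.DivMod
open import Data.Nat.Divisibility using (_∣_; ∣⇒≤; m∣m*n; m%n≡0⇒n∣m)
open import Data.Nat.GCD using (module Bézout)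
open import Data.Nat.ListAction using () renaming (sum to sumL)
open import Data.Nat.ListAction.Properties using (sum-++)
open import Data.Nat.Primality using (Prime; euclidsLemma; prime⇒nonTrivial)
open import Data.Nat.Properties
open import Data.Nat.Tactic.RingSolver using (solve-∀)
open import Data.Product using (∃-syntax; _×_; _,_; proj₁; proj₂)
open import Data.Sum using (inj₁; inj₂)
open import Data.Vec using (Vec; []; _∷_; sum; map; zipWith; foldr)
open import Data.Vec.Functional using () renaming (foldr to foldrᶠ)
open import Function using (_∘_; id; case_of_; Equivalence)
open import Level using (0ℓ)
open import Relation.Binary.Bundles using (Setoid)
open import Relation.Binary.PropositionalEquality
import Relation.Binary.Reasoning.Setoid as SetoidReasoning
open import Relation.Nullary using (¬_; yes; no)

-- Let a be representatives of π, so S = Σ aᵢ ≡ 1 (mod p) and hence Sᵖ ≡ 1 (mod p²).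
-- Expanding Sᵖ one variable at a time by the binomial theorem gives Sᵖ = Σ aᵢᵖ + p F,
-- where F is a sum of terms (p choose k)/p · xᵏ yᵖ⁻ᵏ with 0 < k < p, so H_p(π) ≡ F (mod p).
-- By Wilson's theorem (p choose k)/p ≡ −1/(k! (p−k)!) (mod p), and the multinomial theorem
-- in degrees below p turns −F into the sum of aʳ/r! over the exponent vectors of h.

sumTo : ℕ → (ℕ → ℕ) → ℕ
sumTo zero    f = 0
sumTo (suc n) f = f 0 + sumTo n (f ∘ suc)

sumTo-cong : ∀ n {f g} → (∀ {k} → k < n → f k ≡ g k) → sumTo n f ≡ sumTo n g
sumTo-cong zero    f≗g = refl
sumTo-cong (suc n) f≗g = cong₂ _+_ (f≗g z<s) (sumTo-cong n (f≗g ∘ s<s))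

sumTo-*ˡ : ∀ n c f → c * sumTo n f ≡ sumTo n (λ k → c * f k)
sumTo-*ˡ zero    c f = *-zeroʳ c
sumTo-*ˡ (suc n) c f = trans (*-distribˡ-+ c (f 0) _) (cong (c * f 0 +_) (sumTo-*ˡ n c (f ∘ suc)))

sumTo-+ : ∀ n f g → sumTo n (λ k → f k + g k) ≡ sumTo n f + sumTo n g
sumTo-+ zero    f g = refl
sumTo-+ (suc n) f g = trans (cong (f 0 + g 0 +_) (sumTo-+ n (f ∘ suc) (g ∘ suc))) (interchange (f 0) (g 0) _ _)
  where
  interchange : ∀ a b c d → a + b + (c + d) ≡ a + c + (b + d)
  interchange = solve-∀

sumTo-zero : ∀ n → sumTo n (λ _ → 0) ≡ 0
sumTo-zero zero    = refl
sumTo-zero (suc n) = sumTo-zero n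

sumTo-last : ∀ n f → sumTo (suc n) f ≡ sumTo n f + f n
sumTo-last zero    f = +-comm (f 0) 0
sumTo-last (suc n) f = trans (cong (f 0 +_) (sumTo-last n (f ∘ suc))) (sym (+-assoc (f 0) _ _))

sumTo-truncate : ∀ {d n} f → d < n → sumTo n (λ k → if k <ᵇ suc d then f k else 0) ≡ sumTo (suc d) f
sumTo-truncate {zero}  {suc n} f _   = cong (f 0 +_) (sumTo-zero n)
sumTo-truncate {suc d} {suc n} f d<n = cong (f 0 +_) (sumTo-truncate (f ∘ suc) (s<s⁻¹ d<n))

sumOver : ∀ {A : Set} → List A → (A → ℕ) → ℕ
sumOver xs f = sumL (mapL f xs)

sumOver-cong : ∀ {A : Set} (xs : List A) {f g : A → ℕ} → (∀ x → f x ≡ g x) → sumOver xs f ≡ sumOver xs g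
sumOver-cong xs f≗g = cong sumL (map-cong f≗g xs)

sumOver-*ˡ : ∀ {A : Set} (xs : List A) c f → sumOver xs (λ x → c * f x) ≡ c * sumOver xs f
sumOver-*ˡ []       c f = sym (*-zeroʳ c)
sumOver-*ˡ (x ∷ xs) c f = trans (cong (c * f x +_) (sumOver-*ˡ xs c f)) (sym (*-distribˡ-+ c (f x) _))

sumOver-zero : ∀ {A : Set} (xs : List A) → sumOver xs (λ _ → 0) ≡ 0
sumOver-zero []       = refl
sumOver-zero (x ∷ xs) = sumOver-zero xs

sumOver-if : ∀ {A : Set} (xs : List A) b c f →
             sumOver xs (λ x → if b then c * f x else 0) ≡ (if b then c * sumOver xs f else 0)
sumOver-if xs true  c f = sumOver-*ˡ xs c f
sumOver-if xs false c f = sumOver-zero xs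

sumOver-concatMap : ∀ {A B : Set} (xs : List A) (g : A → List B) f →
                    sumOver (concatMap g xs) f ≡ sumOver xs (λ x → sumOver (g x) f)
sumOver-concatMap []       g f = refl
sumOver-concatMap (x ∷ xs) g f = trans (cong sumL (map-++ f (g x) (concatMap g xs)))
  (trans (sum-++ (mapL f (g x)) _) (cong (sumOver (g x) f +_) (sumOver-concatMap xs g f)))

sumOver-map : ∀ {A B : Set} (xs : List A) (g : A → B) f → sumOver (mapL g xs) f ≡ sumOver xs (f ∘ g)
sumOver-map []       g f = refl
sumOver-map (x ∷ xs) g f = cong (f (g x) +_) (sumOver-map xs g f)

sumOver-applyUpTo : ∀ n (g : ℕ → ℕ) f → sumOver (applyUpTo g n) f ≡ sumTo n (f ∘ g)
sumOver-applyUpTo zero    g f = refl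
sumOver-applyUpTo (suc n) g f = cong (f (g 0) +_) (sumOver-applyUpTo n (g ∘ suc) f)

sumOver-filter : ∀ {n} (rs : List (Vec ℕ n)) f d →
                 sumOver (filter (λ r → sum r ≟ d) rs) f ≡ sumOver rs (λ r → if sum r ≡ᵇ d then f r else 0)
sumOver-filter []       f d = refl
sumOver-filter (r ∷ rs) f d with sum r ≡ᵇ d
... | true  = cong (f r +_) (sumOver-filter rs f d)
... | false = sumOver-filter rs f d

k+s≡ᵇd : ∀ k s d → (k + s ≡ᵇ d) ≡ (if k <ᵇ suc d then s ≡ᵇ d ∸ k else false)
k+s≡ᵇd zero    s d       = refl
k+s≡ᵇd (suc k) s zero    = refl
k+s≡ᵇd (suc k) s (suc d) = k+s≡ᵇd k s d

binomial-theorem : ∀ n x y → (x + y) ^ n ≡ sumTo (suc n) (λ k → (n C k) * (x ^ k * y ^ (n ∸ k)))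
binomial-theorem n x y = begin
    (x + y) ^ n
  ≡⟨ ^≡^ (x + y) n ⟨
    (x + y) ^′ n
  ≡⟨ Binomial.theorem +-*-commutativeSemiring n x y ⟩
    foldrᶠ _+_ 0 {suc n} (λ k → (n C toℕ k) ×′ (x ^′ toℕ k * y ^′ (n ∸ toℕ k)))
  ≡⟨ foldr≡sumTo (suc n) (λ k → (n C k) ×′ (x ^′ k * y ^′ (n ∸ k))) ⟩
    sumTo (suc n) (λ k → (n C k) ×′ (x ^′ k * y ^′ (n ∸ k)))
  ≡⟨ sumTo-cong (suc n) (λ {k} _ →
       trans (×≡* (n C k) _) (cong ((n C k) *_) (cong₂ _*_ (^≡^ x k) (^≡^ y (n ∸ k))))) ⟩
    sumTo (suc n) (λ k → (n C k) * (x ^ k * y ^ (n ∸ k)))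
  ∎
  where
  open ≡-Reasoning
  open RawSemiring +-*-rawSemiring using () renaming (_^_ to _^′_; _×_ to _×′_)
  ^≡^ : ∀ x n → x ^′ n ≡ x ^ n
  ^≡^ x zero    = refl
  ^≡^ x (suc n) = cong (x *_) (^≡^ x n)
  ×≡* : ∀ n x → n ×′ x ≡ n * x
  ×≡* zero    x = refl
  ×≡* (suc n) x = cong (x +_) (×≡* n x)
  foldr≡sumTo : ∀ m (g : ℕ → ℕ) → foldrᶠ _+_ 0 {m} (g ∘ toℕ) ≡ sumTo m g
  foldr≡sumTo zero    g = refl
  foldr≡sumTo (suc m) g = cong (g 0 +_) (foldr≡sumTo m (g ∘ suc))

nCk*[k!*[n∸k]!]≡n! : ∀ {n k} → k ≤ n → (n C k) * (k ! * (n ∸ k) !) ≡ n !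
nCk*[k!*[n∸k]!]≡n! {n} {k} k≤n = trans (cong (_* (k ! * (n ∸ k) !)) (nCk≡n!/k![n-k]! k≤n))
  (m/n*n≡m {{k !* (n ∸ k) !≢0}} (k![n∸k]!∣n! k≤n))

prodWhere : (ℕ → Bool) → ℕ → ℕ
prodWhere s zero    = 1
prodWhere s (suc N) = (if s N then N else 1) * prodWhere s N

infixl 6 _∖_
_∖_ : (ℕ → Bool) → ℕ → ℕ → Bool
(s ∖ x) k = if k ≡ᵇ x then false else s k

∖-self : ∀ s x → (s ∖ x) x ≡ false
∖-self s x with x ≡ᵇ x in eq
... | true  = refl
... | false = ⊥-elim (subst T eq (≡⇒≡ᵇ x x refl))

∖-other : ∀ s {x k} → k ≢ x → (s ∖ x) k ≡ s k
∖-other s {x} {k} k≢x with k ≡ᵇ x in eq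
... | true  = ⊥-elim (k≢x (≡ᵇ⇒≡ k x (subst T (sym eq) _)))
... | false = refl

∖-member : ∀ s {x k} → (s ∖ x) k ≡ true → s k ≡ true × k ≢ x
∖-member s {x} {k} s′k with k ≡ᵇ x in eq
... | false = s′k , λ k≡x → subst T eq (≡⇒≡ᵇ k x k≡x)

prodWhere-cong : ∀ {s t} N → (∀ {k} → k < N → s k ≡ t k) → prodWhere s N ≡ prodWhere t N
prodWhere-cong zero    _   = refl
prodWhere-cong (suc N) s≗t =
  cong₂ (λ b r → (if b then N else 1) * r) (s≗t ≤-refl) (prodWhere-cong N (s≗t ∘ m<n⇒m<1+n))

prodWhere-remove : ∀ s {x} N → s x ≡ true → x < N → prodWhere s N ≡ x * prodWhere (s ∖ x) N
prodWhere-remove s {x} (suc N) sx x<1+N with x ≟ N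
... | yes refl = begin
  (if s x then x else 1) * prodWhere s x    ≡⟨ cong (λ b → (if b then x else 1) * prodWhere s x) sx ⟩
  x * prodWhere s x                         ≡⟨ cong (x *_) (prodWhere-cong x (λ k<x → sym (∖-other s (<⇒≢ k<x)))) ⟩
  x * prodWhere (s ∖ x) x                   ≡⟨ cong (x *_) (*-identityˡ _) ⟨
  x * (1 * prodWhere (s ∖ x) x)             ≡⟨ cong (λ b → x * ((if b then x else 1) * prodWhere (s ∖ x) x)) (∖-self s x) ⟨
  x * prodWhere (s ∖ x) (suc x)             ∎
  where open ≡-Reasoning
... | no x≢N = begin
  c * prodWhere s N                         ≡⟨ cong (c *_) (prodWhere-remove s N sx (≤∧≢⇒< (s≤s⁻¹ x<1+N) x≢N)) ⟩
  c * (x * prodWhere (s ∖ x) N)             ≡⟨ swap c x _ ⟩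
  x * (c * prodWhere (s ∖ x) N)             ≡⟨ cong (λ b → x * ((if b then N else 1) * prodWhere (s ∖ x) N)) (∖-other s (x≢N ∘ sym)) ⟨
  x * prodWhere (s ∖ x) (suc N)             ∎
  where
  open ≡-Reasoning
  c : ℕ
  c = if s N then N else 1
  swap : ∀ a b c → a * (b * c) ≡ b * (a * c)
  swap = solve-∀

prodWhere-factorial : ∀ m → prodWhere (1 <ᵇ_) (suc m) ≡ m !
prodWhere-factorial zero          = refl
prodWhere-factorial (suc zero)    = refl
prodWhere-factorial (suc (suc m)) = cong (suc (suc m) *_) (prodWhere-factorial (suc m))

first-satisfying : (c : ℕ → Bool) {F : List ℕ → ℕ} {K : ℕ → List ℕ → Bool → ℕ} →
  (∀ y ys → F (y ∷ ys) ≡ K y ys (c y)) →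
  (∀ y ys → K y ys true ≡ y) →
  (∀ y ys → K y ys false ≡ F ys) →
  ∀ y ys b → b ≡ c y → Any (T ∘ c) (y ∷ ys) → T (c (K y ys b))
first-satisfying c unfold stop skip y ys true c≡ _ rewrite stop y ys = subst T c≡ _
first-satisfying c unfold stop skip y ys false c≡ (here cy) = ⊥-elim (subst T (sym c≡) cy)
first-satisfying c {F} {K} unfold stop skip y (z ∷ zs) false c≡ (there found)
  rewrite skip y (z ∷ zs) | unfold z zs =
  first-satisfying c {F} {K} unfold stop skip z zs (c z) refl found

1-[1+n]≡-n : ∀ n → ℤ.+ 1 ℤ.- ℤ.+ suc n ≡ ℤ.- ℤ.+ n
1-[1+n]≡-n zero    = refl
1-[1+n]≡-n (suc n) = refl

-n/ℕd≡-[n/d] : ∀ n d .{{_ : NonZero d}} → n % d ≡ 0 → (ℤ.- ℤ.+ n) /ℕ d ≡ ℤ.- ℤ.+ (n / d)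
-n/ℕd≡-[n/d] zero    (suc _)   _   = refl
-n/ℕd≡-[n/d] (suc n) d@(suc _) d∣n with suc n % d | d∣n
... | .0 | refl = refl

-n%ℕd≡[d∸n%d]%d : ∀ n d .{{_ : NonZero d}} → (ℤ.- ℤ.+ n) %ℕ d ≡ (d ∸ n % d) % d
-n%ℕd≡[d∸n%d]%d zero    d@(suc _)   = sym (n%n≡0 d)
-n%ℕd≡[d∸n%d]%d (suc n) d@(suc d-1) with suc n % d
... | zero  = sym (n%n≡0 d)
... | suc r = sym (m<n⇒m%n≡m (s≤s (m∸n≤m d-1 r)))

[1-[1+dm]]/d%d≡[d∸m%d]%d : ∀ d m .{{_ : NonZero d}} → ((ℤ.+ 1 ℤ.- ℤ.+ (1 + d * m)) /ℕ d) %ℕ d ≡ (d ∸ m % d) % d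
[1-[1+dm]]/d%d≡[d∸m%d]%d d m = begin
  ((ℤ.+ 1 ℤ.- ℤ.+ (1 + d * m)) /ℕ d) %ℕ d   ≡⟨ cong (λ z → (z /ℕ d) %ℕ d) (1-[1+n]≡-n (d * m)) ⟩
  ((ℤ.- ℤ.+ (d * m)) /ℕ d) %ℕ d             ≡⟨ cong (_%ℕ d) (-n/ℕd≡-[n/d] (d * m) d (trans (cong (_% d) (*-comm d m)) (m*n%n≡0 m d))) ⟩
  (ℤ.- ℤ.+ (d * m / d)) %ℕ d                ≡⟨ cong (λ z → (ℤ.- ℤ.+ z) %ℕ d) (trans (cong (_/ d) (*-comm d m)) (m*n/n≡m m d)) ⟩
  (ℤ.- ℤ.+ m) %ℕ d                          ≡⟨ -n%ℕd≡[d∸n%d]%d m d ⟩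
  (d ∸ m % d) % d                           ∎
  where open ≡-Reasoning

[1+m*t]^k≡1+k*[m*t]+m*m*u : ∀ m t k → ∃[ u ] (1 + m * t) ^ k ≡ 1 + k * (m * t) + m * m * u
[1+m*t]^k≡1+k*[m*t]+m*m*u m t zero    = 0 , base m
  where base : ∀ m → 1 ≡ 1 + 0 + m * m * 0
        base = solve-∀
[1+m*t]^k≡1+k*[m*t]+m*m*u m t (suc k) with [1+m*t]^k≡1+k*[m*t]+m*m*u m t k
... | u , eq = u + k * t * t + m * t * u , trans (cong ((1 + m * t) *_) eq) (step m t k u)
  where step : ∀ m t k u → (1 + m * t) * (1 + k * (m * t) + m * m * u)
                         ≡ 1 + suc k * (m * t) + m * m * (u + k * t * t + m * t * u)
        step = solve-∀

module Congruence (p : ℕ) .{{_ : NonZero p}} where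

  infix 4 _≈_
  record _≈_ (m n : ℕ) : Set where
    constructor mod
    field ≡-mod : m % p ≡ n % p
  open _≈_ public

  ≈-setoid : Setoid 0ℓ 0ℓ
  ≈-setoid = record
    { Carrier       = ℕ
    ; _≈_           = _≈_
    ; isEquivalence = record
      { refl  = mod refl
      ; sym   = λ (mod e) → mod (sym e)
      ; trans = λ (mod e) (mod f) → mod (trans e f)
      }
    }

  open Setoid ≈-setoid public
    using () renaming (refl to ≈-refl; sym to ≈-sym; trans to ≈-trans; reflexive to ≈-reflexive)
  module ≈-Reasoning = SetoidReasoning ≈-setoid

  m%p≈m : ∀ m → m % p ≈ m
  m%p≈m m = mod (m%n%n≡m%n m p)

  +-cong : ∀ {m n u v} → m ≈ n → u ≈ v → m + u ≈ n + v
  +-cong {m} {n} {u} {v} (mod e) (mod f) = mod (begin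
    (m + u) % p           ≡⟨ %-distribˡ-+ m u p ⟩
    (m % p + u % p) % p   ≡⟨ cong₂ (λ a b → (a + b) % p) e f ⟩
    (n % p + v % p) % p   ≡⟨ %-distribˡ-+ n v p ⟨
    (n + v) % p           ∎)
    where open ≡-Reasoning

  *-cong : ∀ {m n u v} → m ≈ n → u ≈ v → m * u ≈ n * v
  *-cong {m} {n} {u} {v} (mod e) (mod f) = mod (begin
    (m * u) % p               ≡⟨ %-distribˡ-* m u p ⟩
    (m % p * (u % p)) % p     ≡⟨ cong₂ (λ a b → (a * b) % p) e f ⟩
    (n % p * (v % p)) % p     ≡⟨ %-distribˡ-* n v p ⟨
    (n * v) % p               ∎)
    where open ≡-Reasoning

  +-congˡ : ∀ m {u v} → u ≈ v → m + u ≈ m + v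
  +-congˡ m = +-cong (≈-refl {m})

  +-congʳ : ∀ u {m n} → m ≈ n → m + u ≈ n + u
  +-congʳ u e = +-cong e (≈-refl {u})

  *-congˡ : ∀ m {u v} → u ≈ v → m * u ≈ m * v
  *-congˡ m = *-cong (≈-refl {m})

  *-congʳ : ∀ u {m n} → m ≈ n → m * u ≈ n * u
  *-congʳ u e = *-cong e (≈-refl {u})

  sumTo-cong-≈ : ∀ n {f g} → (∀ {k} → k < n → f k ≈ g k) → sumTo n f ≈ sumTo n g
  sumTo-cong-≈ zero    f≈g = ≈-refl
  sumTo-cong-≈ (suc n) f≈g = +-cong (f≈g z<s) (sumTo-cong-≈ n (f≈g ∘ s<s))

  sumOver-% : ∀ {A : Set} (xs : List A) f → sumOver xs (λ x → f x % p) ≈ sumOver xs f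
  sumOver-% []       f = ≈-refl
  sumOver-% (x ∷ xs) f = +-cong (m%p≈m (f x)) (sumOver-% xs f)

  p*n≈0 : ∀ n → p * n ≈ 0
  p*n≈0 n = mod (begin
    (p * n) % p   ≡⟨ cong (_% p) (*-comm p n) ⟩
    (n * p) % p   ≡⟨ m*n%n≡0 n p ⟩
    0             ≡⟨ m*n%n≡0 0 p ⟨
    0 % p         ∎)
    where open ≡-Reasoning

  ≈0⇒∣ : ∀ {n} → n ≈ 0 → p ∣ n
  ≈0⇒∣ {n} (mod e) = m%n≡0⇒n∣m n p (trans e (m*n%n≡0 0 p))

  +-cancelʳ-≈ : ∀ k {m n} → m + k ≈ n + k → m ≈ n
  +-cancelʳ-≈ k {m} {n} e = begin
      m                  ≡⟨ +-identityʳ m ⟨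
      m + 0              ≈⟨ +-congˡ m (≈-sym k+k′≈0) ⟩
      m + (k + k′)       ≡⟨ +-assoc m k k′ ⟨
      m + k + k′         ≈⟨ +-congʳ k′ e ⟩
      n + k + k′         ≡⟨ +-assoc n k k′ ⟩
      n + (k + k′)       ≈⟨ +-congˡ n k+k′≈0 ⟩
      n + 0              ≡⟨ +-identityʳ n ⟩
      n                  ∎
    where
    open ≈-Reasoning
    k′ : ℕ
    k′ = p ∸ k % p
    k+k′≈0 : k + k′ ≈ 0
    k+k′≈0 = begin
      k + k′         ≈⟨ +-congʳ k′ (≈-sym (m%p≈m k)) ⟩
      k % p + k′     ≡⟨ m+[n∸m]≡n (<⇒≤ (m%n<n k p)) ⟩
      p              ≡⟨ *-identityʳ p ⟨
      p * 1          ≈⟨ p*n≈0 1 ⟩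
      0              ∎

  ≈⇒≡ : ∀ {m n} → m < p → n < p → m ≈ n → m ≡ n
  ≈⇒≡ m<p n<p (mod e) = trans (sym (m<n⇒m%n≡m m<p)) (trans e (m<n⇒m%n≡m n<p))

  inverse-unique : ∀ {x x′ y} → x < p → x′ < p → x * y ≈ 1 → x′ * y ≈ 1 → x ≡ x′
  inverse-unique {x} {x′} {y} x<p x′<p xy≈1 x′y≈1 = ≈⇒≡ x<p x′<p (begin
      x                ≡⟨ *-identityʳ x ⟨
      x * 1            ≈⟨ *-congˡ x (≈-sym x′y≈1) ⟩
      x * (x′ * y)     ≡⟨ swap x x′ y ⟩
      x′ * (x * y)     ≈⟨ *-congˡ x′ xy≈1 ⟩
      x′ * 1           ≡⟨ *-identityʳ x′ ⟩
      x′               ∎)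
    where
    open ≈-Reasoning
    swap : ∀ a b c → a * (b * c) ≡ b * (a * c)
    swap = solve-∀

  negated-inverse : ∀ x y → 1 + y * x ≈ 0 → x * ((p ∸ 1) * y) ≈ 1
  negated-inverse x y 1+yx≈0 = +-cancelʳ-≈ (y * x) (begin
      x * ((p ∸ 1) * y) + y * x   ≡⟨ regroup x (p ∸ 1) y ⟩
      suc (p ∸ 1) * (y * x)       ≡⟨ cong (_* (y * x)) (suc-pred p) ⟩
      p * (y * x)                 ≈⟨ p*n≈0 (y * x) ⟩
      0                           ≈⟨ ≈-sym 1+yx≈0 ⟩
      1 + y * x                   ∎)
    where
    open ≈-Reasoning
    regroup : ∀ x q y → x * (q * y) + y * x ≡ suc q * (y * x)
    regroup = solve-∀

  invMod-inverse : ∀ x {y} → x * y ≈ 1 → y < p → x * invMod p x ≈ 1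
  invMod-inverse x (mod xy≈1) y<p =
    mod (≡ᵇ⇒≡ _ _ (search (Any.map (λ where refl → ≡⇒≡ᵇ _ _ xy≈1) (∈-upTo⁺ y<p))))
    where
    c : ℕ → Bool
    c z = (x * z) % p ≡ᵇ 1 % p
    -- The search inside invMod has no name, so the unfolding equations are instantiated
    -- before upTo p is abstracted; unification then identifies F and K with that search.
    search : Any (T ∘ c) (upTo p) → T (c (invMod p x))
    search found with first-satisfying c (λ _ _ → refl) (λ _ _ → refl) (λ _ _ → refl) | upTo p | found
    ... | first | y ∷ ys | found′ with c y in cy
    ... | b = first y ys b (sym cy) found′

  Paired : (ℕ → Bool) → ℕ → Set
  Paired s N = ∀ {z} → z < N → s z ≡ true → ∃[ w ] w < N × s w ≡ true × z * w ≈ 1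

  SelfInverseFree : (ℕ → Bool) → ℕ → Set
  SelfInverseFree s N = ∀ {z} → z < N → s z ≡ true → ¬ z * z ≈ 1

  -- The largest member N is removed together with its partner y, its unique inverse
  -- below p; no other member has N or y as partner.
  prodWhere-paired≈1 : ∀ s N → N ≤ p → SelfInverseFree s N → Paired s N → prodWhere s N ≈ 1
  prodWhere-paired≈1 s zero    _     _        _      = ≈-refl
  prodWhere-paired≈1 s (suc N) 1+N≤p noSquare paired with s N in sN
  ... | false = ≈-trans (≈-reflexive (*-identityˡ _))
                  (prodWhere-paired≈1 s N (<⇒≤ 1+N≤p) (noSquare ∘ m<n⇒m<1+n) paired-below)
    where
    paired-below : Paired s N
    paired-below z<N sz with paired (m<n⇒m<1+n z<N) sz
    ... | w , w<1+N , sw , zw≈1 =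
      w , ≤∧≢⇒< (s≤s⁻¹ w<1+N) (λ where refl → case trans (sym sN) sw of λ ()) , sw , zw≈1
  ... | true with paired ≤-refl sN
  ... | y , y<1+N , sy , Ny≈1 = begin
      N * prodWhere s N                   ≡⟨ cong (N *_) (prodWhere-remove s N sy y<N) ⟩
      N * (y * prodWhere (s ∖ y) N)       ≡⟨ *-assoc N y _ ⟨
      N * y * prodWhere (s ∖ y) N         ≈⟨ *-cong Ny≈1 (prodWhere-paired≈1 (s ∖ y) N (<⇒≤ 1+N≤p) noSquare′ paired′) ⟩
      1                                   ∎
    where
    open ≈-Reasoning
    y<N : y < N
    y<N = ≤∧≢⇒< (s≤s⁻¹ y<1+N) (λ where refl → noSquare ≤-refl sN Ny≈1)
    yN≈1 : y * N ≈ 1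
    yN≈1 = ≈-trans (≈-reflexive (*-comm y N)) Ny≈1
    noSquare′ : SelfInverseFree (s ∖ y) N
    noSquare′ z<N s′z = noSquare (m<n⇒m<1+n z<N) (proj₁ (∖-member s s′z))
    paired′ : Paired (s ∖ y) N
    paired′ {z} z<N s′z with ∖-member s s′z
    ... | sz , z≢y with paired (m<n⇒m<1+n z<N) sz
    ... | w , w<1+N , sw , zw≈1 = w , w<N , trans (∖-other s w≢y) sw , zw≈1
      where
      z<p : z < p
      z<p = <-≤-trans z<N (<⇒≤ 1+N≤p)
      w≢y : w ≢ y
      w≢y refl = <⇒≢ z<N (inverse-unique z<p 1+N≤p zw≈1 Ny≈1)
      w<N : w < N
      w<N = ≤∧≢⇒< (s≤s⁻¹ w<1+N) (λ where refl → z≢y (inverse-unique z<p (<-trans y<N 1+N≤p) zw≈1 yN≈1))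

module PrimeModulus (p : ℕ) .{{_ : NonZero p}} (p-prime : Prime p) where
  open Congruence p

  1<p : 1 < p
  1<p = nonTrivial⇒n>1 p {{prime⇒nonTrivial p-prime}}

  inverse-exists : ∀ {x} → ¬ p ∣ x → ∃[ y ] y < p × x * y ≈ 1
  inverse-exists {x} p∤x with inverse-of-residue (coprime-Bézout (prime⇒coprime p-prime (m%n<n x p)))
    where
    r : ℕ
    r = x % p
    instance
      r≢0 : NonZero r
      r≢0 = ≢-nonZero (p∤x ∘ m%n≡0⇒n∣m x p)
    inverse-of-residue : Bézout.Identity 1 p r → ∃[ y ] x * y ≈ 1
    inverse-of-residue (Bézout.-+ a b 1+ap≡br) = b , (begin
      x * b       ≈⟨ *-congʳ b (≈-sym (m%p≈m x)) ⟩
      r * b       ≡⟨ *-comm r b ⟩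
      b * r       ≡⟨ 1+ap≡br ⟨
      1 + a * p   ≡⟨ cong (1 +_) (*-comm a p) ⟩
      1 + p * a   ≈⟨ +-congˡ 1 (p*n≈0 a) ⟩
      1           ∎)
      where open ≈-Reasoning
    inverse-of-residue (Bézout.+- a b 1+br≡ap) =
      (p ∸ 1) * b , ≈-trans (*-congʳ ((p ∸ 1) * b) (≈-sym (m%p≈m x)))
                            (negated-inverse r b (≈-trans (≈-reflexive (trans 1+br≡ap (*-comm a p))) (p*n≈0 a)))
  ... | y , xy≈1 = y % p , m%n<n y p , ≈-trans (*-congˡ x (m%p≈m y)) xy≈1

  p∤k! : ∀ {k} → k < p → ¬ p ∣ k !
  p∤k! {zero}  k<p p∣1 = <⇒≱ 1<p (∣⇒≤ p∣1)
  p∤k! {suc k} k<p p∣k! with euclidsLemma (suc k) (k !) p-prime p∣k!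
  ... | inj₁ p∣1+k = <⇒≱ k<p (∣⇒≤ p∣1+k)
  ... | inj₂ p∣k!′ = p∤k! (<-trans (n<1+n k) k<p) p∣k!′

  invFact : ℕ → ℕ
  invFact k = invMod p (k !)

  k!*invFact≈1 : ∀ {k} → k < p → k ! * invFact k ≈ 1
  k!*invFact≈1 {k} k<p with inverse-exists (p∤k! k<p)
  ... | y , y<p , k!y≈1 = invMod-inverse (k !) k!y≈1 y<p

  private
    <p∸1⇒<p : ∀ {z} → z < p ∸ 1 → z < p
    <p∸1⇒<p z<p∸1 = <-≤-trans z<p∸1 (m∸n≤m p 1)
    p∤suc : ∀ {z} → suc z < p → ¬ p ∣ suc z
    p∤suc 1+z<p p∣1+z = <⇒≱ 1+z<p (∣⇒≤ p∣1+z)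

  squareRootFree : SelfInverseFree (1 <ᵇ_) (p ∸ 1)
  squareRootFree {suc (suc j)} z<p∸1 _ z²≈1 with euclidsLemma (suc j) (suc (suc (suc j))) p-prime p∣z²-1
    where
    factor : ∀ j → suc j * suc (suc (suc j)) + 1 ≡ suc (suc j) * suc (suc j)
    factor = solve-∀
    p∣z²-1 : p ∣ suc j * suc (suc (suc j))
    p∣z²-1 = ≈0⇒∣ (+-cancelʳ-≈ 1 (≈-trans (≈-reflexive (factor j)) z²≈1))
  ... | inj₁ p∣j+1 = p∤suc (<-trans (m<n⇒m<1+n (n<1+n _)) (m≤pred[n]⇒suc[m]≤n z<p∸1)) p∣j+1
  ... | inj₂ p∣j+3 = p∤suc (m≤pred[n]⇒suc[m]≤n z<p∸1) p∣j+3

  inversesPaired : Paired (1 <ᵇ_) (p ∸ 1)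
  inversesPaired {z@(suc (suc j))} z<p∸1 _ with inverse-exists (p∤suc (<p∸1⇒<p z<p∸1))
  ... | zero , _ , z*0≈1 =
    case ≈⇒≡ (>-nonZero⁻¹ p) 1<p (≈-trans (≈-reflexive (sym (*-zeroʳ z))) z*0≈1) of λ ()
  ... | suc zero , _ , z*1≈1 =
    case ≈⇒≡ (<p∸1⇒<p z<p∸1) 1<p (≈-trans (≈-reflexive (sym (*-identityʳ z))) z*1≈1) of λ ()
  ... | y@(suc (suc _)) , y<p , zy≈1 = y , ≤∧≢⇒< (<⇒≤pred y<p) y≢p∸1 , refl , zy≈1
    where
    open ≈-Reasoning
    y≢p∸1 : y ≢ p ∸ 1
    y≢p∸1 y≡p∸1 = p∤suc (m≤pred[n]⇒suc[m]≤n z<p∸1) (≈0⇒∣ (begin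
      1 + z                ≈⟨ +-congʳ z (subst (λ y → z * y ≈ 1) y≡p∸1 zy≈1) ⟨
      z * (p ∸ 1) + z      ≡⟨ +-comm (z * (p ∸ 1)) z ⟩
      z + z * (p ∸ 1)      ≡⟨ *-suc z (p ∸ 1) ⟨
      z * suc (p ∸ 1)      ≡⟨ cong (z *_) (suc-pred p) ⟩
      z * p                ≡⟨ *-comm z p ⟩
      p * z                ≈⟨ p*n≈0 z ⟩
      0                    ∎))

  wilson : (p ∸ 1) ! ≈ p ∸ 1
  wilson = begin
    (p ∸ 1) !                                  ≡⟨ cong _! p∸1≡1+k ⟩
    suc k * k !                                ≡⟨ cong (suc k *_) (prodWhere-factorial k) ⟨
    suc k * prodWhere (1 <ᵇ_) (suc k)          ≡⟨ cong (λ m → m * prodWhere (1 <ᵇ_) m) p∸1≡1+k ⟨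
    (p ∸ 1) * prodWhere (1 <ᵇ_) (p ∸ 1)        ≈⟨ *-congˡ (p ∸ 1)
                                                    (prodWhere-paired≈1 (1 <ᵇ_) (p ∸ 1) (m∸n≤m p 1) squareRootFree inversesPaired) ⟩
    (p ∸ 1) * 1                                ≡⟨ *-identityʳ (p ∸ 1) ⟩
    p ∸ 1                                      ∎
    where
    open ≈-Reasoning
    k : ℕ
    k = p ∸ 2
    p∸1≡1+k : p ∸ 1 ≡ suc k
    p∸1≡1+k = cong (_∸ 1) (sym (m+[n∸m]≡n 1<p))

  ≈1⇒≡1+p*[x/p] : ∀ {x} → x ≈ 1 → x ≡ 1 + p * (x / p)
  ≈1⇒≡1+p*[x/p] {x} (mod x%p≡1%p) = begin
    x                      ≡⟨ m≡m%n+[m/n]*n x p ⟩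
    x % p + x / p * p      ≡⟨ cong₂ _+_ (trans x%p≡1%p (m<n⇒m%n≡m 1<p)) (*-comm (x / p) p) ⟩
    1 + p * (x / p)        ∎
    where open ≡-Reasoning

  ≈1⇒^p≡1+p*[p*u] : ∀ {x} → x ≈ 1 → ∃[ u ] x ^ p ≡ 1 + p * (p * u)
  ≈1⇒^p≡1+p*[p*u] {x} x≈1 with [1+m*t]^k≡1+k*[m*t]+m*m*u p (x / p) p
  ... | u , [1+pt]^p = x / p + u , (begin
    x ^ p                                   ≡⟨ cong (_^ p) (≈1⇒≡1+p*[x/p] x≈1) ⟩
    (1 + p * (x / p)) ^ p                   ≡⟨ [1+pt]^p ⟩
    1 + p * (p * (x / p)) + p * p * u       ≡⟨ regroup p (x / p) u ⟩
    1 + p * (p * (x / p + u))               ∎)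
    where
    open ≡-Reasoning
    regroup : ∀ p t u → 1 + p * (p * t) + p * p * u ≡ 1 + p * (p * (t + u))
    regroup = solve-∀

  p!≡p*[p∸1]! : p ! ≡ p * (p ∸ 1) !
  p!≡p*[p∸1]! = trans (cong _! (sym (suc-pred p))) (cong (_* (p ∸ 1) !) (suc-pred p))

  p∣pCk : ∀ {k} → 0 < k → k < p → p ∣ p C k
  p∣pCk {k} 0<k k<p with euclidsLemma (p C k) (k ! * (p ∸ k) !) p-prime p∣pCk*k!*[p∸k]!
    where
    p∣pCk*k!*[p∸k]! : p ∣ (p C k) * (k ! * (p ∸ k) !)
    p∣pCk*k!*[p∸k]! = subst (p ∣_) (sym (trans (nCk*[k!*[n∸k]!]≡n! (<⇒≤ k<p)) p!≡p*[p∸1]!)) (m∣m*n ((p ∸ 1) !))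
  ... | inj₁ p∣pCk = p∣pCk
  ... | inj₂ p∣k!*[p∸k]! with euclidsLemma (k !) ((p ∸ k) !) p-prime p∣k!*[p∸k]!
  ...   | inj₁ p∣k!     = ⊥-elim (p∤k! k<p p∣k!)
  ...   | inj₂ p∣[p∸k]! = ⊥-elim (p∤k! (∸-monoʳ-< 0<k (<⇒≤ k<p)) p∣[p∸k]!)

  binomialQuotient : ℕ → ℕ
  binomialQuotient k = (p C k) / p

  p*binomialQuotient : ∀ {k} → 0 < k → k < p → p * binomialQuotient k ≡ p C k
  p*binomialQuotient 0<k k<p = m*[n/m]≡n (p∣pCk 0<k k<p)

  frobeniusQuotient : ℕ → ℕ → ℕ
  frobeniusQuotient x y = sumTo (p ∸ 1) (λ j → binomialQuotient (suc j) * (x ^ suc j * y ^ (p ∸ suc j)))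

  frobenius : ∀ x y → (x + y) ^ p ≡ x ^ p + y ^ p + p * frobeniusQuotient x y
  frobenius x y = begin
    (x + y) ^ p                                          ≡⟨ binomial-theorem p x y ⟩
    b 0 + sumTo p (b ∘ suc)                              ≡⟨ cong (λ m → b 0 + sumTo m (b ∘ suc)) (suc-pred p) ⟨
    b 0 + sumTo (suc (p ∸ 1)) (b ∘ suc)                  ≡⟨ cong (b 0 +_) (sumTo-last (p ∸ 1) (b ∘ suc)) ⟩
    b 0 + (sumTo (p ∸ 1) (b ∘ suc) + b (suc (p ∸ 1)))    ≡⟨ cong₂ _+_ first (cong₂ _+_ middle last) ⟩
    y ^ p + (p * frobeniusQuotient x y + x ^ p)          ≡⟨ rearrange (y ^ p) _ (x ^ p) ⟩
    x ^ p + y ^ p + p * frobeniusQuotient x y            ∎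
    where
    open ≡-Reasoning
    b : ℕ → ℕ
    b k = (p C k) * (x ^ k * y ^ (p ∸ k))
    rearrange : ∀ a b c → a + (b + c) ≡ c + a + b
    rearrange = solve-∀
    first : b 0 ≡ y ^ p
    first = trans (*-identityˡ _) (*-identityˡ _)
    last : b (suc (p ∸ 1)) ≡ x ^ p
    last = begin
      b (suc (p ∸ 1))                  ≡⟨ cong b (suc-pred p) ⟩
      (p C p) * (x ^ p * y ^ (p ∸ p))  ≡⟨ cong₂ (λ c e → c * (x ^ p * y ^ e)) (nCn≡1 p) (n∸n≡0 p) ⟩
      1 * (x ^ p * 1)                  ≡⟨ trans (*-identityˡ _) (*-identityʳ _) ⟩
      x ^ p                            ∎
    middle : sumTo (p ∸ 1) (b ∘ suc) ≡ p * frobeniusQuotient x y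
    middle = trans (sumTo-cong (p ∸ 1) λ {j} j<p∸1 → trans
                      (cong (_* (x ^ suc j * y ^ (p ∸ suc j))) (sym (p*binomialQuotient z<s (m≤pred[n]⇒suc[m]≤n j<p∸1))))
                      (*-assoc p _ _))
                   (sym (sumTo-*ˡ (p ∸ 1) p _))

  invFact-binomial : ∀ {k d} → k ≤ d → d < p → invFact k * invFact (d ∸ k) ≈ (d C k) * invFact d
  invFact-binomial {k} {d} k≤d d<p = begin
    ι k * ι (d ∸ k)                                         ≡⟨ *-identityʳ _ ⟨
    ι k * ι (d ∸ k) * 1                                     ≈⟨ *-congˡ (ι k * ι (d ∸ k)) (k!*invFact≈1 d<p) ⟨
    ι k * ι (d ∸ k) * (d ! * ι d)                           ≡⟨ cong (λ m → ι k * ι (d ∸ k) * (m * ι d)) (nCk*[k!*[n∸k]!]≡n! k≤d) ⟨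
    ι k * ι (d ∸ k) * ((d C k) * (k ! * (d ∸ k) !) * ι d)   ≡⟨ regroup (ι k) (ι (d ∸ k)) (d C k) (k !) ((d ∸ k) !) (ι d) ⟩
    k ! * ι k * ((d ∸ k) ! * ι (d ∸ k) * ((d C k) * ι d))   ≈⟨ *-cong (k!*invFact≈1 (≤-<-trans k≤d d<p))
                                                                  (*-congʳ ((d C k) * ι d) (k!*invFact≈1 (≤-<-trans (m∸n≤m d k) d<p))) ⟩
    1 * (1 * ((d C k) * ι d))                               ≡⟨ trans (*-identityˡ _) (*-identityˡ _) ⟩
    (d C k) * ι d                                           ∎
    where
    open ≈-Reasoning
    ι : ℕ → ℕ
    ι = invFact
    regroup : ∀ a b c e f g → a * b * (c * (e * f) * g) ≡ e * a * (f * b * (c * g))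
    regroup = solve-∀

  binomialQuotient*k!*[p∸k]!≡[p∸1]! : ∀ {k} → 0 < k → k < p →
                                      binomialQuotient k * (k ! * (p ∸ k) !) ≡ (p ∸ 1) !
  binomialQuotient*k!*[p∸k]!≡[p∸1]! {k} 0<k k<p = *-cancelˡ-≡ _ _ p (begin
    p * (c * (k ! * (p ∸ k) !))    ≡⟨ *-assoc p c _ ⟨
    p * c * (k ! * (p ∸ k) !)      ≡⟨ cong (_* (k ! * (p ∸ k) !)) (p*binomialQuotient 0<k k<p) ⟩
    (p C k) * (k ! * (p ∸ k) !)    ≡⟨ nCk*[k!*[n∸k]!]≡n! (<⇒≤ k<p) ⟩
    p !                            ≡⟨ p!≡p*[p∸1]! ⟩
    p * (p ∸ 1) !                  ∎)
    where
    open ≡-Reasoning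
    c : ℕ
    c = binomialQuotient k

  binomialQuotient+invFact≈0 : ∀ {k} → 0 < k → k < p → binomialQuotient k + invFact k * invFact (p ∸ k) ≈ 0
  binomialQuotient+invFact≈0 {k} 0<k k<p = begin
    c + X                                          ≡⟨ cong (_+ X) (trans (*-identityʳ _) (*-identityʳ c)) ⟨
    c * 1 * 1 + X                                  ≈⟨ +-congʳ X (*-cong (*-congˡ c (k!*invFact≈1 k<p)) (k!*invFact≈1 p∸k<p)) ⟨
    c * (k ! * ι k) * ((p ∸ k) ! * ι (p ∸ k)) + X  ≡⟨ cong (_+ X) (regroup c (k !) (ι k) ((p ∸ k) !) (ι (p ∸ k))) ⟩
    c * (k ! * (p ∸ k) !) * X + X                  ≡⟨ cong (λ m → m * X + X) (binomialQuotient*k!*[p∸k]!≡[p∸1]! 0<k k<p) ⟩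
    (p ∸ 1) ! * X + X                              ≈⟨ +-congʳ X (*-congʳ X wilson) ⟩
    (p ∸ 1) * X + X                                ≡⟨ +-comm ((p ∸ 1) * X) X ⟩
    suc (p ∸ 1) * X                                ≡⟨ cong (_* X) (suc-pred p) ⟩
    p * X                                          ≈⟨ p*n≈0 X ⟩
    0                                              ∎
    where
    open ≈-Reasoning
    ι : ℕ → ℕ
    ι = invFact
    c : ℕ
    c = binomialQuotient k
    X : ℕ
    X = ι k * ι (p ∸ k)
    p∸k<p : p ∸ k < p
    p∸k<p = ∸-monoʳ-< 0<k (<⇒≤ k<p)
    regroup : ∀ c a b e f → c * (a * b) * (e * f) ≡ c * (a * e) * (b * f)
    regroup = solve-∀

  powerSum : ∀ {n} → Vec ℕ n → ℕ
  powerSum a = sum (map (λ a → a ^ p) a)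

  frobeniusQuotientSum : ∀ {n} → Vec ℕ n → ℕ
  frobeniusQuotientSum []      = 0
  frobeniusQuotientSum (x ∷ a) = frobeniusQuotient x (sum a) + frobeniusQuotientSum a

  sum^p≡powerSum+p*frobeniusQuotientSum : ∀ {n} (a : Vec ℕ n) → sum a ^ p ≡ powerSum a + p * frobeniusQuotientSum a
  sum^p≡powerSum+p*frobeniusQuotientSum []      = trans (cong (0 ^_) (sym (suc-pred p))) (sym (*-zeroʳ p))
  sum^p≡powerSum+p*frobeniusQuotientSum (x ∷ a) = begin
    (x + sum a) ^ p                                                      ≡⟨ frobenius x (sum a) ⟩
    x ^ p + sum a ^ p + p * frobeniusQuotient x (sum a)                 ≡⟨ cong (λ m → x ^ p + m + p * frobeniusQuotient x (sum a))
                                                                              (sum^p≡powerSum+p*frobeniusQuotientSum a) ⟩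
    x ^ p + (powerSum a + p * frobeniusQuotientSum a) + p * frobeniusQuotient x (sum a)
                                                                         ≡⟨ regroup (x ^ p) (powerSum a) p _ _ ⟩
    x ^ p + powerSum a + p * (frobeniusQuotient x (sum a) + frobeniusQuotientSum a)  ∎
    where
    open ≡-Reasoning
    regroup : ∀ u v p m b → u + (v + p * m) + p * b ≡ u + v + p * (b + m)
    regroup = solve-∀

module TruncatedExponential (p : ℕ) .{{_ : NonZero p}} (p-prime : Prime p) where
  open Congruence p
  open PrimeModulus p p-prime

  monomial : ∀ {n} → Vec ℕ n → Vec ℕ n → ℕ
  monomial x r = foldr _ _*_ 1 (zipWith _^_ x r)

  invFactorial : ∀ {n} → Vec ℕ n → ℕ
  invFactorial r = foldr _ _*_ 1 (map invFact r)

  -- xʳ / r!; the summand term p x r of h is scaledMonomial x r % p.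
  scaledMonomial : ∀ {n} → Vec ℕ n → Vec ℕ n → ℕ
  scaledMonomial x r = monomial x r * invFactorial r

  -- The degree-d part of ∏ᵢ ∑_{k<p} xᵢᵏ / k!.
  truncExp : ∀ {n} → Vec ℕ n → ℕ → ℕ
  truncExp {n} x d = sumOver (tuples p n) (λ r → if sum r ≡ᵇ d then scaledMonomial x r else 0)

  truncExp-cons : ∀ {n} y (x : Vec ℕ n) d →
    truncExp (y ∷ x) d ≡ sumTo p (λ k → if k <ᵇ suc d then y ^ k * invFact k * truncExp x (d ∸ k) else 0)
  truncExp-cons {n} y x d = begin
      truncExp (y ∷ x) d
    ≡⟨ sumOver-concatMap (upTo p) (λ k → mapL (k ∷_) (tuples p n)) summand ⟩
      sumOver (upTo p) (λ k → sumOver (mapL (k ∷_) (tuples p n)) summand)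
    ≡⟨ sumOver-applyUpTo p id _ ⟩
      sumTo p (λ k → sumOver (mapL (k ∷_) (tuples p n)) summand)
    ≡⟨ sumTo-cong p (λ {k} _ → slice k) ⟩
      sumTo p (λ k → if k <ᵇ suc d then y ^ k * invFact k * truncExp x (d ∸ k) else 0)
    ∎
    where
    open ≡-Reasoning
    summand : Vec ℕ (suc n) → ℕ
    summand r = if sum r ≡ᵇ d then scaledMonomial (y ∷ x) r else 0
    summand-cons : ∀ k r → summand (k ∷ r) ≡
      (if k <ᵇ suc d then y ^ k * invFact k * (if sum r ≡ᵇ d ∸ k then scaledMonomial x r else 0) else 0)
    summand-cons k r rewrite k+s≡ᵇd k (sum r) d with k <ᵇ suc d | sum r ≡ᵇ d ∸ k
    ... | false | _     = refl
    ... | true  | true  = regroup (y ^ k) (monomial x r) (invFact k) (invFactorial r)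
      where regroup : ∀ a u c v → a * u * (c * v) ≡ a * c * (u * v)
            regroup = solve-∀
    ... | true  | false = sym (*-zeroʳ (y ^ k * invFact k))
    slice : ∀ k → sumOver (mapL (k ∷_) (tuples p n)) summand ≡
                  (if k <ᵇ suc d then y ^ k * invFact k * truncExp x (d ∸ k) else 0)
    slice k = begin
      sumOver (mapL (k ∷_) (tuples p n)) summand    ≡⟨ sumOver-map (tuples p n) (k ∷_) summand ⟩
      sumOver (tuples p n) (summand ∘ (k ∷_))       ≡⟨ sumOver-cong (tuples p n) (summand-cons k) ⟩
      sumOver (tuples p n) (λ r → if k <ᵇ suc d then y ^ k * invFact k * (if sum r ≡ᵇ d ∸ k then scaledMonomial x r else 0) else 0)
                                                    ≡⟨ sumOver-if (tuples p n) (k <ᵇ suc d) (y ^ k * invFact k) _ ⟩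
      (if k <ᵇ suc d then y ^ k * invFact k * truncExp x (d ∸ k) else 0) ∎

  truncExp-multinomial : ∀ {n} (x : Vec ℕ n) {d} → d < p → truncExp x d ≈ sum x ^ d * invFact d
  truncExp-multinomial []      {zero}  0<p = ≈-sym (k!*invFact≈1 0<p)
  truncExp-multinomial []      {suc d} _   = ≈-refl
  truncExp-multinomial (y ∷ x) {d}     d<p = begin
      truncExp (y ∷ x) d
    ≡⟨ truncExp-cons y x d ⟩
      sumTo p (λ k → if k <ᵇ suc d then y ^ k * ι k * truncExp x (d ∸ k) else 0)
    ≡⟨ sumTo-truncate _ d<p ⟩
      sumTo (suc d) (λ k → y ^ k * ι k * truncExp x (d ∸ k))
    ≈⟨ sumTo-cong-≈ (suc d) (λ {k} k≤d →
         ≈-trans (*-congˡ (y ^ k * ι k) (truncExp-multinomial x (≤-<-trans (m∸n≤m d k) d<p)))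
                 (coefficient (s≤s⁻¹ k≤d))) ⟩
      sumTo (suc d) (λ k → ι d * ((d C k) * (y ^ k * s ^ (d ∸ k))))
    ≡⟨ sumTo-*ˡ (suc d) (ι d) (λ k → (d C k) * (y ^ k * s ^ (d ∸ k))) ⟨
      ι d * sumTo (suc d) (λ k → (d C k) * (y ^ k * s ^ (d ∸ k)))
    ≡⟨ cong (ι d *_) (binomial-theorem d y s) ⟨
      ι d * (y + s) ^ d
    ≡⟨ *-comm (ι d) _ ⟩
      (y + s) ^ d * ι d
    ∎
    where
    open ≈-Reasoning
    ι : ℕ → ℕ
    ι = invFact
    s : ℕ
    s = sum x
    coefficient : ∀ {k} → k ≤ d → y ^ k * ι k * (s ^ (d ∸ k) * ι (d ∸ k)) ≈ ι d * ((d C k) * (y ^ k * s ^ (d ∸ k)))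
    coefficient {k} k≤d = begin
      y ^ k * ι k * (s ^ (d ∸ k) * ι (d ∸ k))       ≡⟨ regroup (y ^ k) (ι k) (s ^ (d ∸ k)) (ι (d ∸ k)) ⟩
      y ^ k * s ^ (d ∸ k) * (ι k * ι (d ∸ k))       ≈⟨ *-congˡ (y ^ k * s ^ (d ∸ k)) (invFact-binomial k≤d d<p) ⟩
      y ^ k * s ^ (d ∸ k) * ((d C k) * ι d)         ≡⟨ rotate (y ^ k * s ^ (d ∸ k)) (d C k) (ι d) ⟩
      ι d * ((d C k) * (y ^ k * s ^ (d ∸ k)))       ∎
      where
      regroup : ∀ a b c e → a * b * (c * e) ≡ a * c * (b * e)
      regroup = solve-∀
      rotate : ∀ a b c → a * (b * c) ≡ c * (b * a)
      rotate = solve-∀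

  crossTerms : ℕ → ℕ → ℕ
  crossTerms y s = sumTo (p ∸ 1) (λ j → y ^ suc j * invFact (suc j) * (s ^ (p ∸ suc j) * invFact (p ∸ suc j)))

  frobeniusQuotient+crossTerms≈0 : ∀ y s → frobeniusQuotient y s + crossTerms y s ≈ 0
  frobeniusQuotient+crossTerms≈0 y s = begin
    frobeniusQuotient y s + crossTerms y s    ≡⟨ sumTo-+ (p ∸ 1) (λ j → c j * (u j * v j)) (λ j → u j * a j * (v j * b j)) ⟨
    sumTo (p ∸ 1) (λ j → c j * (u j * v j) + u j * a j * (v j * b j))
                                              ≈⟨ sumTo-cong-≈ (p ∸ 1) (λ {j} j<p∸1 → termwise j (m≤pred[n]⇒suc[m]≤n j<p∸1)) ⟩
    sumTo (p ∸ 1) (λ _ → 0)                   ≡⟨ sumTo-zero (p ∸ 1) ⟩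
    0                                         ∎
    where
    open ≈-Reasoning
    c u v a b : ℕ → ℕ
    c j = binomialQuotient (suc j)
    u j = y ^ suc j
    v j = s ^ (p ∸ suc j)
    a j = invFact (suc j)
    b j = invFact (p ∸ suc j)
    factor : ∀ c u v a b → c * (u * v) + u * a * (v * b) ≡ (c + a * b) * (u * v)
    factor = solve-∀
    termwise : ∀ j → suc j < p → c j * (u j * v j) + u j * a j * (v j * b j) ≈ 0
    termwise j 1+j<p = begin
      c j * (u j * v j) + u j * a j * (v j * b j)   ≡⟨ factor (c j) (u j) (v j) (a j) (b j) ⟩
      (c j + a j * b j) * (u j * v j)               ≈⟨ *-congʳ (u j * v j) (binomialQuotient+invFact≈0 z<s 1+j<p) ⟩
      0                                             ∎

  -- h ≡ −hSum (mod p).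
  hSum : ∀ {n} → Vec ℕ n → ℕ
  hSum {n} x = sumOver (exponents p n) (scaledMonomial x)

  hSum≡truncExp : ∀ {n} (x : Vec ℕ n) → hSum x ≡ truncExp x p
  hSum≡truncExp {n} x = sumOver-filter (tuples p n) (scaledMonomial x) p

  hSum-cons : ∀ {n} y (x : Vec ℕ n) →
    hSum (y ∷ x) ≈ hSum x + crossTerms y (sum x)
  hSum-cons y x = begin
      hSum (y ∷ x)
    ≡⟨ hSum≡truncExp (y ∷ x) ⟩
      truncExp (y ∷ x) p
    ≡⟨ truncExp-cons y x p ⟩
      sumTo p (λ k → if k <ᵇ suc p then f k else 0)
    ≡⟨ sumTo-cong p (λ {k} k<p → cong (if_then f k else 0) (k<ᵇ1+p k<p)) ⟩
      sumTo p f
    ≡⟨ cong (λ m → sumTo m f) (suc-pred p) ⟨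
      f 0 + sumTo (p ∸ 1) (f ∘ suc)
    ≈⟨ +-cong f0≈hSum (sumTo-cong-≈ (p ∸ 1) λ {j} j<p∸1 →
         *-congˡ (y ^ suc j * invFact (suc j))
                 (truncExp-multinomial x (∸-monoʳ-< z<s (<⇒≤ (m≤pred[n]⇒suc[m]≤n j<p∸1))))) ⟩
      hSum x + crossTerms y (sum x)
    ∎
    where
    open ≈-Reasoning
    f : ℕ → ℕ
    f k = y ^ k * invFact k * truncExp x (p ∸ k)
    k<ᵇ1+p : ∀ {k} → k < p → (k <ᵇ suc p) ≡ true
    k<ᵇ1+p k<p = Equivalence.to T-≡ (<⇒<ᵇ (m<n⇒m<1+n k<p))
    f0≈hSum : f 0 ≈ hSum x
    f0≈hSum = begin
      1 * invFact 0 * truncExp x p    ≈⟨ *-congʳ (truncExp x p) (k!*invFact≈1 (>-nonZero⁻¹ p)) ⟩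
      1 * truncExp x p                ≡⟨ *-identityˡ _ ⟩
      truncExp x p                    ≡⟨ hSum≡truncExp x ⟨
      hSum x                          ∎

  frobeniusQuotientSum+hSum≈0 : ∀ {n} (x : Vec ℕ n) → frobeniusQuotientSum x + hSum x ≈ 0
  frobeniusQuotientSum+hSum≈0 []      = ≈-reflexive (trans (hSum≡truncExp []) (cong (truncExp []) (sym (suc-pred p))))
  frobeniusQuotientSum+hSum≈0 (y ∷ x) = begin
    B + F + hSum (y ∷ x)      ≈⟨ +-congˡ (B + F) (hSum-cons y x) ⟩
    B + F + (hSum x + C)      ≡⟨ regroup B F (hSum x) C ⟩
    (B + C) + (F + hSum x)    ≈⟨ +-cong (frobeniusQuotient+crossTerms≈0 y (sum x)) (frobeniusQuotientSum+hSum≈0 x) ⟩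
    0                         ∎
    where
    open ≈-Reasoning
    B : ℕ
    B = frobeniusQuotient y (sum x)
    C : ℕ
    C = crossTerms y (sum x)
    F : ℕ
    F = frobeniusQuotientSum x
    regroup : ∀ b f h c → b + f + (h + c) ≡ (b + c) + (f + h)
    regroup = solve-∀

  -- (sum a)ᵖ = powerSum a + p F and (sum a)ᵖ ≡ 1 (mod p²), so (powerSum a − 1)/p ≡ −F (mod p).
  powerSum-quotient : ∀ {n} (a : Vec ℕ n) → sum a ≈ 1 →
    powerSum a ≡ 1 + p * (powerSum a / p) × powerSum a / p ≈ hSum a
  powerSum-quotient a Σa≈1 with ≈1⇒^p≡1+p*[p*u] Σa≈1
  ... | u , Σa^p = Q≡1+pm , (begin
    m                  ≡⟨ +-identityʳ m ⟨
    m + 0              ≈⟨ +-congˡ m (frobeniusQuotientSum+hSum≈0 a) ⟨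
    m + (F + hSum a)   ≡⟨ +-assoc m F (hSum a) ⟨
    m + F + hSum a     ≡⟨ cong (_+ hSum a) m+F≡pu ⟩
    p * u + hSum a     ≈⟨ +-congʳ (hSum a) (p*n≈0 u) ⟩
    hSum a             ∎)
    where
    open ≈-Reasoning
    Q : ℕ
    Q = powerSum a
    F : ℕ
    F = frobeniusQuotientSum a
    m : ℕ
    m = Q / p
    Q+pF≡1+ppu : Q + p * F ≡ 1 + p * (p * u)
    Q+pF≡1+ppu = trans (sym (sum^p≡powerSum+p*frobeniusQuotientSum a)) Σa^p
    Q≡1+pm : Q ≡ 1 + p * m
    Q≡1+pm = ≈1⇒≡1+p*[x/p] (+-cancelʳ-≈ (p * F) (begin
      Q + p * F          ≡⟨ Q+pF≡1+ppu ⟩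
      1 + p * (p * u)    ≈⟨ +-congˡ 1 (p*n≈0 (p * u)) ⟩
      1                  ≈⟨ +-congˡ 1 (p*n≈0 F) ⟨
      1 + p * F          ∎))
    m+F≡pu : m + F ≡ p * u
    m+F≡pu = *-cancelˡ-≡ _ _ p (+-cancelˡ-≡ 1 _ _
               (trans (distrib p m F) (trans (cong (_+ p * F) (sym Q≡1+pm)) Q+pF≡1+ppu)))
      where
      distrib : ∀ p m f → 1 + p * (m + f) ≡ 1 + p * m + p * f
      distrib = solve-∀

proposition8p2 : (p : ℕ) .{{_ : NonZero p}} → Prime p →
    (n : ℕ) → n ≥ 1 → (π : Vec (Fin p) n) → InΠ p π →
    Hp p π ≡ h p π
proposition8p2 p p-prime n _ π Σπ≡1 = begin
  Hp p π                                    ≡⟨ cong (λ q → ((ℤ.+ 1 ℤ.- ℤ.+ q) /ℕ p) %ℕ p) Q≡1+pm ⟩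
  ((ℤ.+ 1 ℤ.- ℤ.+ (1 + p * m)) /ℕ p) %ℕ p   ≡⟨ [1-[1+dm]]/d%d≡[d∸m%d]%d p m ⟩
  (p ∸ m % p) % p                           ≡⟨ cong (λ z → (p ∸ z) % p) (≡-mod m≈h) ⟩
  h p π                                     ∎
  where
  open ≡-Reasoning
  open Congruence p
  open PrimeModulus p p-prime
  open TruncatedExponential p p-prime
  a : Vec ℕ n
  a = rep π
  m : ℕ
  m = powerSum a / p
  Q≡1+pm : powerSum a ≡ 1 + p * m
  Q≡1+pm = proj₁ (powerSum-quotient a (mod Σπ≡1))
  m≈h : m ≈ sumOver (exponents p n) (term p a)
  m≈h = ≈-trans (proj₂ (powerSum-quotient a (mod Σπ≡1)))
                (≈-sym (sumOver-% (exponents p n) (scaledMonomial a)))
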